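{- $\mathcal{TC}(\mathrm{RL}_1^P)=\mathrm{FIN}$, where $\mathrm{FIN}$ is the family of finite languages.
   Context: A right-linear grammar is $G=(N,T,P,S)$ with rules of the form $A\to wB$ or $A\to w$, $A,B\in N$, $w\in T^*$. $\mathrm{RL}_n^P$ is the family of regular languages generated by some right-linear grammar with at most $n$ production rules. A tree-controlled grammar is a quintuple $G=(N,T,P,S,R)$ where $(N,T,P,S)$ is a context-free grammar whose rules are all non-erasing (the only exception being that $S\to\lambda$ is allowed if $S$ does not occur on the right-hand side of any rule), and $R$ is a regular language over $N\cup T$. For a derivation tree, the word of level $j$ is the word formed by all nodes of depth $j$ read from left to right. $L(G)$ consists of all $z\in T^*$ having a derivation tree $t$ whose leaves read left to right give $z$ and such that the words of all levels of $t$, except the last one, belong to $R$. For a family $\mathcal{F}$ of regular languages, $\mathcal{TC}(\mathcal{F})$ is the family of languages $L(G)$ of tree-controlled grammars with $R\in\mathcal{F}$. -}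

module Defs where

open import Data.Nat using (ℕ; zero; suc; _≤_; _<_; _⊔_)
open import Data.Fin using (Fin)
open import Data.List using (List; []; _∷_; _++_; [_]; map; length)
open import Data.List.Relation.Unary.All using (All)
open import Data.List.Membership.Propositional using (_∈_; _∉_)
open import Data.Sum using (_⊎_; inj₁; inj₂)
open import Data.Product using (Σ; _×_; _,_)
open import Data.Maybe using (Maybe; just; nothing)
open import Function.Bundles using (_⇔_)
open import Relation.Binary.PropositionalEquality using (_≡_; _≢_)

-- Right-linear grammars over an alphabet V.
-- A rule (A , w , just B) is A → wB, a rule (A , w , nothing) is A → w.

record RLGrammar (V : Set) : Set where
  field
    nN    : ℕ
    start : Fin nN
    rules : List (Fin nN × List V × Maybe (Fin nN))

open RLGrammar public

data RLDerives {V : Set} (G : RLGrammar V) : Fin (nN G) → List V → Set where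
  rl-term : ∀ {A w} → (A , w , nothing) ∈ rules G → RLDerives G A w
  rl-cont : ∀ {A w B z} → (A , w , just B) ∈ rules G → RLDerives G B z →
            RLDerives G A (w ++ z)

RLLang : {V : Set} → RLGrammar V → List V → Set
RLLang G w = RLDerives G (start G) w

InRLP : ℕ → {V : Set} → (List V → Set) → Set
InRLP n {V} R =
  Σ (RLGrammar V) λ G → (length (rules G) ≤ n) × (∀ w → R w ⇔ RLLang G w)

-- Derivation trees (labels: nonterminals N at inner nodes, terminals T
-- at leaves; a node with no children represents a rule A → λ).

data DTree (N T : Set) : Set where
  leaf : T → DTree N T
  node : N → List (DTree N T) → DTree N T

module _ {N T : Set} where

  label : DTree N T → N ⊎ T
  label (leaf a)   = inj₂ a
  label (node A _) = inj₁ A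

  mutual
    yield : DTree N T → List T
    yield (leaf a)    = [ a ]
    yield (node _ ts) = yields ts

    yields : List (DTree N T) → List T
    yields []       = []
    yields (t ∷ ts) = yield t ++ yields ts

  mutual
    -- depth of the deepest node (λ-leaves counted, i.e. a node with no
    -- children has a λ child one level below it)
    height : DTree N T → ℕ
    height (leaf _)    = 0
    height (node _ ts) = suc (heights ts)

    heights : List (DTree N T) → ℕ
    heights []       = 0
    heights (t ∷ ts) = height t ⊔ heights ts

  mutual
    level : ℕ → DTree N T → List (N ⊎ T)
    level zero    t           = [ label t ]
    level (suc j) (leaf _)    = []
    level (suc j) (node _ ts) = levels j ts

    levels : ℕ → List (DTree N T) → List (N ⊎ T)
    levels j []       = []
    levels j (t ∷ ts) = level j t ++ levels j ts

record TCGrammar (k : ℕ) : Set₁ where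
  field
    nN      : ℕ
    start   : Fin nN
    rules   : List (Fin nN × List (Fin nN ⊎ Fin k))
    control : List (Fin nN ⊎ Fin k) → Set
    nonErasing : ∀ {A α} → (A , α) ∈ rules →
      α ≢ [] ⊎ (A ≡ start × (∀ {B β} → (B , β) ∈ rules → inj₁ start ∉ β))

module _ {k : ℕ} (G : TCGrammar k) where
  open TCGrammar G renaming (nN to N#; start to S; rules to P)

  data Valid : DTree (Fin N#) (Fin k) → Set where
    v-leaf : ∀ {a} → Valid (leaf a)
    v-node : ∀ {A ts} → (A , map label ts) ∈ P → All Valid ts → Valid (node A ts)

  TCLang : List (Fin k) → Set
  TCLang z = Σ (DTree (Fin N#) (Fin k)) λ t →
    Valid t × label t ≡ inj₁ S × yield t ≡ z ×
    (∀ j → j < height t → control (level j t))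

InTC-RL1P : {k : ℕ} → (List (Fin k) → Set) → Set₁
InTC-RL1P {k} L = Σ (TCGrammar k) λ G →
  InRLP 1 (TCGrammar.control G) × (∀ w → L w ⇔ TCLang G w)

Finite : {k : ℕ} → (List (Fin k) → Set) → Set
Finite {k} L = Σ (List (List (Fin k))) λ ws → ∀ w → L w ⇔ w ∈ ws

{-# OPTIONS --safe #-}
-- A right-linear grammar with a single rule generates at most one word. The
-- level-0 word of every derivation tree is S, so either the control language
-- misses S and the language is empty, or the control language is exactly {S}.
-- In the latter case every controlled tree is a chain S - S - … - S ending in
-- a rule S → z with z terminal, so the language is the finite set of terminal
-- right-hand sides of S. Conversely a finite language is generated by the
-- rules S → z for its words under the control {S}, itself generated by the
-- single right-linear rule X → S.
module Submission where

open import Defs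
open import Data.Nat using (ℕ; zero; suc; _≤_; _<_; z≤n; s≤s)
open import Data.Nat.Properties using (≤-trans; m≤m⊔n; ⊔-identityʳ)
open import Data.Fin using (Fin) renaming (zero to fzero)
open import Data.Fin.Properties using (_≟_)
open import Data.List using (List; []; _∷_; [_]; map; length)
open import Data.List.Properties using (++-identityʳ; map-∘; map-injective)
import Data.List.Properties as List
open import Data.List.Relation.Unary.All using (universal; _∷_)
open import Data.List.Relation.Unary.All.Properties using (map⁺)
open import Data.List.Relation.Unary.Any using (here; there)
open import Data.List.Membership.Propositional using (_∈_; _∉_)
open import Data.List.Membership.Propositional.Properties using (∈-map⁺; ∈-map⁻)
import Data.List.Membership.DecPropositional as DecMembership
open import Data.Sum using (_⊎_; inj₁; inj₂)
open import Data.Sum.Properties using (inj₂-injective)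
import Data.Sum.Properties as Sum
open import Data.Product using (Σ; ∃; _×_; _,_)
open import Data.Product.Properties using (,-injectiveˡ; ,-injectiveʳ)
import Data.Product.Properties as Product
open import Data.Maybe using (Maybe; nothing)
import Data.Maybe.Properties as Maybe
open import Data.Empty using (⊥-elim)
open import Relation.Nullary using (Dec; yes; no)
import Relation.Nullary.Decidable as Dec
open import Relation.Unary using (Decidable)
open import Relation.Binary.Definitions using (DecidableEquality)
open import Relation.Binary.PropositionalEquality
  using (_≡_; _≢_; refl; sym; trans; cong; subst)
open import Function using (_∘_; Injective)
open import Function.Bundles using (_⇔_; mk⇔; Equivalence)
open import Function.Properties.Equivalence using ()
  renaming (refl to ⇔-refl; sym to ⇔-sym; trans to ⇔-trans)

open Equivalence using (to; from)

length≤1⇒∈-unique : ∀ {A : Set} (xs : List A) → length xs ≤ 1 →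
                    ∀ {x y} → x ∈ xs → y ∈ xs → x ≡ y
length≤1⇒∈-unique (_ ∷ [])    _         (here refl) (here refl) = refl
length≤1⇒∈-unique (_ ∷ _ ∷ _) (s≤s ()) _ _

∈-map⇔ : ∀ {A B : Set} {f : A → B} → Injective _≡_ _≡_ f →
         ∀ {x xs} → f x ∈ map f xs ⇔ x ∈ xs
∈-map⇔ {f = f} f-inj = mk⇔ from-map (∈-map⁺ f)
  where
  from-map : ∀ {x xs} → f x ∈ map f xs → x ∈ xs
  from-map p with ∈-map⁻ f p
  ... | _ , x′∈xs , fx≡fx′ = subst (_∈ _) (sym (f-inj fx≡fx′)) x′∈xs

preimage-finite : ∀ {A B : Set} (f : A → B) → Injective _≡_ _≡_ f →
                  (∀ b → Dec (∃ λ a → f a ≡ b)) →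
                  (bs : List B) → Σ (List A) λ as → ∀ a → f a ∈ bs ⇔ a ∈ as
preimage-finite f f-inj image? [] = [] , λ _ → mk⇔ (λ ()) (λ ())
preimage-finite f f-inj image? (b ∷ bs) with preimage-finite f f-inj image? bs | image? b
... | as , as⇔ | no b∉image = as , λ a → mk⇔
  (λ { (here refl) → ⊥-elim (b∉image (a , refl)) ; (there p) → to (as⇔ a) p })
  (there ∘ from (as⇔ a))
... | as , as⇔ | yes (a₀ , refl) = a₀ ∷ as , λ a → mk⇔
  (λ { (here e) → here (f-inj e) ; (there p) → there (to (as⇔ a) p) })
  (λ { (here refl) → here refl ; (there p) → there (from (as⇔ a) p) })

map-inj₂-image? : ∀ {A B : Set} (α : List (A ⊎ B)) → Dec (∃ λ z → map inj₂ z ≡ α)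
map-inj₂-image? []           = yes ([] , refl)
map-inj₂-image? (inj₁ _ ∷ α) = no λ { ([] , ()) ; (_ ∷ _ , ()) }
map-inj₂-image? (inj₂ b ∷ α) with map-inj₂-image? α
... | yes (z , refl) = yes (b ∷ z , refl)
... | no  α∉image    = no λ { (_ ∷ z , refl) → α∉image (z , refl) }

module _ {V : Set} (G : RLGrammar V) (one-rule : length (rules G) ≤ 1) where

  RLDerives⇒terminal-rule : ∀ {A w} → RLDerives G A w → (A , w , nothing) ∈ rules G
  RLDerives⇒terminal-rule (rl-term p) = p
  RLDerives⇒terminal-rule (rl-cont p d)
    with length≤1⇒∈-unique (rules G) one-rule p (RLDerives⇒terminal-rule d)
  ... | ()

  RLLang⇔terminal-rule : ∀ w → RLLang G w ⇔ (start G , w , nothing) ∈ rules G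
  RLLang⇔terminal-rule w = mk⇔ RLDerives⇒terminal-rule rl-term

RL₁-subsingleton : ∀ {V : Set} {R : List V → Set} → InRLP 1 R →
                   ∀ {u v} → R u → R v → u ≡ v
RL₁-subsingleton (G , one-rule , R⇔) {u} {v} Ru Rv =
  ,-injectiveˡ (,-injectiveʳ (length≤1⇒∈-unique (rules G) one-rule
    (to (RLLang⇔terminal-rule G one-rule u) (to (R⇔ u) Ru))
    (to (RLLang⇔terminal-rule G one-rule v) (to (R⇔ v) Rv))))

RL₁-decidable : ∀ {V : Set} {R : List V → Set} → DecidableEquality V → InRLP 1 R →
                Decidable R
RL₁-decidable {V} _≟V_ (G , one-rule , R⇔) w =
  Dec.map (⇔-sym (⇔-trans (R⇔ w) (RLLang⇔terminal-rule G one-rule w)))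
          (DecMembership._∈?_ rule-≟ (start G , w , nothing) (rules G))
  where
  rule-≟ : DecidableEquality (Fin (nN G) × List V × Maybe (Fin (nN G)))
  rule-≟ = Product.≡-dec _≟_ (Product.≡-dec (List.≡-dec _≟V_) (Maybe.≡-dec _≟_))

module _ {N T : Set} where

  yields-leaves : (as : List T) → yields (map (leaf {N}) as) ≡ as
  yields-leaves []       = refl
  yields-leaves (a ∷ as) = cong (a ∷_) (yields-leaves as)

  heights-leaves : (as : List T) → heights (map (leaf {N}) as) ≡ 0
  heights-leaves []       = refl
  heights-leaves (_ ∷ as) = heights-leaves as

  labels-leaves : (as : List T) →
                  map label (map (leaf {N}) as) ≡ map inj₂ (yields (map (leaf {N}) as))
  labels-leaves as = trans (sym (map-∘ as)) (cong (map inj₂) (sym (yields-leaves as)))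

  leaves⊎heights≥1 : (ts : List (DTree N T)) →
                     (∃ λ as → ts ≡ map leaf as) ⊎ 1 ≤ heights ts
  leaves⊎heights≥1 []             = inj₁ ([] , refl)
  leaves⊎heights≥1 (leaf a ∷ ts) with leaves⊎heights≥1 ts
  ... | inj₁ (as , refl) = inj₁ (a ∷ as , refl)
  ... | inj₂ h≥1         = inj₂ h≥1
  leaves⊎heights≥1 (node _ us ∷ ts) =
    inj₂ (≤-trans (s≤s z≤n) (m≤m⊔n (suc (heights us)) (heights ts)))

  level0≡[A]⇒only-child : ∀ {A} (ts : List (DTree N T)) → levels 0 ts ≡ [ inj₁ A ] →
                          ∃ λ us → ts ≡ node A us ∷ []
  level0≡[A]⇒only-child (node _ us ∷ []) refl = us , refl
  level0≡[A]⇒only-child []                 ()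
  level0≡[A]⇒only-child (leaf _ ∷ _)       ()
  level0≡[A]⇒only-child (node _ _ ∷ _ ∷ _) ()

module _ {k : ℕ} (G : TCGrammar k) where
  open TCGrammar G renaming (nN to N#; start to S; rules to P)

  Controlled : DTree (Fin N#) (Fin k) → Set
  Controlled t = ∀ j → j < height t → control (level j t)

  controlled-only-child : ∀ {A t} → Controlled (node A (t ∷ [])) → Controlled t
  controlled-only-child {t = t} ctl j j<h =
    subst control (++-identityʳ (level j t))
          (ctl (suc j) (s≤s (subst (j <_) (sym (⊔-identityʳ (height t))) j<h)))

  TCLang⇒control-start : ∀ {z} → TCLang G z → control [ inj₁ S ]
  TCLang⇒control-start (leaf _ , _ , () , _)
  TCLang⇒control-start (node _ _ , _ , refl , _ , ctl) = ctl 0 (s≤s z≤n)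

  module _ (control⊆[S] : ∀ w → control w → w ≡ [ inj₁ S ]) where

    -- Level 1 must be the word S, so the root has either only leaves or a single child S.
    controlled⇒start-rule : ∀ t → Valid G t → label t ≡ inj₁ S → Controlled t →
                            (S , map inj₂ (yield t)) ∈ P
    controlled⇒start-rule (node _ ts) (v-node p vs) refl ctl with leaves⊎heights≥1 ts
    ... | inj₁ (as , refl) = subst (λ α → (S , α) ∈ P) (labels-leaves as) p
    ... | inj₂ h≥1 with level0≡[A]⇒only-child ts (control⊆[S] _ (ctl 1 (s≤s h≥1)))
    ... | us , refl with vs
    ... | v ∷ _ =
      subst (λ z → (S , map inj₂ z) ∈ P) (sym (++-identityʳ (yields us)))
            (controlled⇒start-rule (node S us) v refl (controlled-only-child ctl))

  TCLang⇔start-rule : control [ inj₁ S ] → (∀ w → control w → w ≡ [ inj₁ S ]) →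
                      ∀ z → TCLang G z ⇔ (S , map inj₂ z) ∈ P
  TCLang⇔start-rule control-S control⊆[S] z = mk⇔ derivable start-rule-tree
    where
    derivable : TCLang G z → (S , map inj₂ z) ∈ P
    derivable (t , valid , root , refl , ctl) =
      controlled⇒start-rule control⊆[S] t valid root ctl

    start-rule-tree : (S , map inj₂ z) ∈ P → TCLang G z
    start-rule-tree p =
      node S (map leaf z) ,
      v-node (subst (λ α → (S , α) ∈ P) (map-∘ z) p) (map⁺ (universal (λ _ → v-leaf) z)) ,
      refl , yields-leaves z , ctl
      where
      ctl : Controlled (node S (map leaf z))
      ctl zero    _         = control-S
      ctl (suc j) (s≤s j<h) with () ← subst (suc j ≤_) (heights-leaves z) j<h

  start-rule-words-finite : Finite (λ z → (S , map inj₂ z) ∈ P)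
  start-rule-words-finite = preimage-finite (λ z → S , map inj₂ z)
    (map-injective inj₂-injective ∘ ,-injectiveʳ) image? P
    where
    image? : ∀ r → Dec (∃ λ z → (S , map inj₂ z) ≡ r)
    image? (A , α) with A ≟ S | map-inj₂-image? α
    ... | yes refl | yes (z , refl) = yes (z , refl)
    ... | no A≢S   | _              = no λ { (_ , refl) → A≢S refl }
    ... | yes _    | no α∉image     = no λ { (z , refl) → α∉image (z , refl) }

TC-RL₁⇒finite : ∀ {k} {L : List (Fin k) → Set} → InTC-RL1P L → Finite L
TC-RL₁⇒finite (G , control∈RL₁ , L⇔)
  with RL₁-decidable (Sum.≡-dec _≟_ _≟_) control∈RL₁ [ inj₁ (TCGrammar.start G) ]
... | no ¬control-S = [] , λ w →
  mk⇔ (λ Lw → ⊥-elim (¬control-S (TCLang⇒control-start G (to (L⇔ w) Lw)))) (λ ())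
... | yes control-S with start-rule-words-finite G
... | ws , ws⇔ = ws , λ w →
  ⇔-trans (L⇔ w) (⇔-trans (TCLang⇔start-rule G control-S control⊆[S] w) (ws⇔ w))
  where
  control⊆[S] : ∀ u → TCGrammar.control G u → u ≡ [ inj₁ (TCGrammar.start G) ]
  control⊆[S] _ control-u = RL₁-subsingleton control∈RL₁ control-u control-S

[S]-grammar : ∀ {k} → RLGrammar (Fin 1 ⊎ Fin k)
[S]-grammar = record { nN = 1 ; start = fzero ; rules = (fzero , [ inj₁ fzero ] , nothing) ∷ [] }

[S]∈RL₁ : ∀ {k} → InRLP 1 (RLLang ([S]-grammar {k}))
[S]∈RL₁ = [S]-grammar , s≤s z≤n , λ _ → ⇔-refl

module _ {k : ℕ} (ws : List (List (Fin k))) where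

  S→word : List (Fin k) → Fin 1 × List (Fin 1 ⊎ Fin k)
  S→word z = fzero , map inj₂ z

  words-grammar : TCGrammar k
  words-grammar = record
    { nN = 1 ; start = fzero ; rules = map S→word ws ; control = RLLang [S]-grammar
    ; nonErasing = start-only-lhs }
    where
    start-only-lhs : ∀ {A α} → (A , α) ∈ map S→word ws →
                     α ≢ [] ⊎ (A ≡ fzero × (∀ {B β} → (B , β) ∈ map S→word ws → inj₁ fzero ∉ β))
    start-only-lhs {fzero} _ = inj₂ (refl , S∉rhs)
      where
      S∉rhs : ∀ {B β} → (B , β) ∈ map S→word ws → inj₁ fzero ∉ β
      S∉rhs p S∈β with ∈-map⁻ S→word p
      ... | z , _ , refl with ∈-map⁻ inj₂ S∈β
      ... | _ , _ , ()

  words-grammar-language : ∀ z → z ∈ ws ⇔ TCLang words-grammar z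
  words-grammar-language z = ⇔-sym (⇔-trans
    (TCLang⇔start-rule words-grammar [S]∈control control⊆[S] z)
    (∈-map⇔ (map-injective inj₂-injective ∘ ,-injectiveʳ)))
    where
    [S]∈control : RLLang [S]-grammar [ inj₁ fzero ]
    [S]∈control = rl-term (here refl)

    control⊆[S] : ∀ u → RLLang [S]-grammar u → u ≡ [ inj₁ fzero ]
    control⊆[S] _ control-u =
      RL₁-subsingleton [S]∈RL₁ control-u [S]∈control

finite⇒TC-RL₁ : ∀ {k} {L : List (Fin k) → Set} → Finite L → InTC-RL1P L
finite⇒TC-RL₁ (ws , L⇔) =
  words-grammar ws , [S]∈RL₁ ,
  λ w → ⇔-trans (L⇔ w) (words-grammar-language ws w)

theorem26 : (k : ℕ) (L : List (Fin k) → Set) → InTC-RL1P L ⇔ Finite L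
theorem26 k L = mk⇔ TC-RL₁⇒finite finite⇒TC-RL₁
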